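{- Let $\varepsilon>0$ be a fixed sufficiently small constant, $C>0$ a fixed constant, and $s=C\log_2 n$. For sufficiently large $n$ the following holds. Let $G\in\mathcal F(n)\setminus\mathcal X_0(n)$, let $x\in V\setminus(K_1(G)\cup K_2(G))$, and let $S\subseteq V$ with $|S|=6s$. Then there exists $Q_x\subseteq\Gamma_x\setminus S$ with $$|Q_x|=\log_2 n\quad\text{and}\quad |V\setminus(K_1(G)\cup K_2(G)\cup\Gamma(Q_x))|<2n^{1-\varepsilon}.$$
   Context: A colored graph is a simple graph with each edge colored red or blue; it is odd-blue-triangle-free (OBTF) if it contains no triangle with an odd number of blue edges. $\mathcal F(n)$ is the set of labelled OBTF colored graphs on $V=[n]$. $\Gamma_x=\Gamma(x)$ is the neighborhood of $x$, and for $Q\subseteq V$, $\Gamma(Q)=\bigcup_{y\in Q}\Gamma_y\setminus Q$. $\mathcal X_0(n)=\{G\in\mathcal F(n):\exists\,Q\subseteq V,\ |Q|=s,\ |\Gamma(Q)|<0.6n\}$. $K_1(G)=\{v: d_G(v)<\varepsilon n\}$. $K_2(G)=\{x_1,\dots,x_l,y_1,\dots,y_l\}$ is a largest possible collection of distinct vertices of $V\setminus K_1(G)$ such that $|\Gamma(x_i)\cap\Gamma(y_i)|<\varepsilon n$ for all $i\in[l]$ (any fixed such maximum collection). Large quantities such as $s$ and $\log_2 n$ are treated as integers.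
   Formalization: The fixed constants ε and C range only over the positive rationals. -}

module Defs where

open import Data.Nat using (ℕ; zero; suc; _+_; _*_; _∸_; _^_; _≤_; _<_; _<ᵇ_)
open import Data.Nat.DivMod using (_/_)
open import Data.Nat.Logarithm using (⌊log₂_⌋)
open import Data.Bool using (Bool; true; false; not; _∧_; _∨_; _xor_)
open import Data.Maybe using (Maybe; just; nothing; is-just)
open import Data.Fin using (Fin; _≟_)
open import Data.Fin.Subset using (Subset; ∣_∣; _∩_; _∈_; _∉_; _⊆_)
open import Data.Vec using (tabulate; lookup)
open import Data.List using (List; []; _∷_; length; concatMap; allFin)
open import Data.Bool.ListAction using (any)
open import Data.List.Relation.Unary.All using (All)
open import Data.List.Relation.Unary.Unique.Propositional using (Unique)
open import Data.Product using (_×_; _,_; ∃-syntax; Σ-syntax)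
open import Relation.Binary.PropositionalEquality using (_≡_)
open import Relation.Nullary using (¬_)
open import Relation.Nullary.Decidable using (⌊_⌋)

data Colour : Set where
  red blue : Colour

isBlue : Colour → Bool
isBlue red  = false
isBlue blue = true

record ColouredGraph (n : ℕ) : Set where
  field
    edge   : Fin n → Fin n → Maybe Colour
    sym    : ∀ x y → edge x y ≡ edge y x
    irrefl : ∀ x → edge x x ≡ nothing
open ColouredGraph public

OBTF : ∀ {n} → ColouredGraph n → Set
OBTF {n} G = ∀ (x y z : Fin n) (c₁ c₂ c₃ : Colour) →
  edge G x y ≡ just c₁ → edge G y z ≡ just c₂ → edge G x z ≡ just c₃ →
  (isBlue c₁ xor isBlue c₂ xor isBlue c₃) ≡ false

adj : ∀ {n} → ColouredGraph n → Fin n → Fin n → Bool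
adj G x y = is-just (edge G x y)

Γ : ∀ {n} → ColouredGraph n → Fin n → Subset n
Γ G x = tabulate (λ y → adj G x y)

deg : ∀ {n} → ColouredGraph n → Fin n → ℕ
deg G x = ∣ Γ G x ∣

ΓS : ∀ {n} → ColouredGraph n → Subset n → Subset n
ΓS {n} G Q = tabulate (λ z → not (lookup Q z) ∧ any (λ y → lookup Q y ∧ adj G y z) (allFin n))

InX₀ : ∀ {n} → ℕ → ColouredGraph n → Set
InX₀ {n} s G = ∃[ Q ] (∣ Q ∣ ≡ s × 10 * ∣ ΓS G Q ∣ < 6 * n)

-- Throughout, ε = a / b with a, b natural numbers.
-- v ∈ K₁(G)  iff  d(v) < ε n  iff  b · d(v) < a · n.
inK₁ : ∀ {n} → ℕ → ℕ → ColouredGraph n → Fin n → Bool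
inK₁ {n} a b G v = b * deg G v <ᵇ a * n

flat : ∀ {n} → List (Fin n × Fin n) → List (Fin n)
flat = concatMap (λ { (x , y) → x ∷ y ∷ [] })

ValidK₂ : ∀ {n} → ℕ → ℕ → ColouredGraph n → List (Fin n × Fin n) → Set
ValidK₂ {n} a b G ps =
  Unique (flat ps) ×
  All (λ { (x , y) → inK₁ a b G x ≡ false × inK₁ a b G y ≡ false ×
                     b * ∣ Γ G x ∩ Γ G y ∣ < a * n }) ps

-- A largest possible such collection (this is K₂(G), any fixed choice).
MaxK₂ : ∀ {n} → ℕ → ℕ → ColouredGraph n → List (Fin n × Fin n) → Set
MaxK₂ a b G ps = ValidK₂ a b G ps × (∀ qs → ValidK₂ a b G qs → length qs ≤ length ps)

inList : ∀ {n} → List (Fin n) → Fin n → Bool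
inList ws v = any (λ w → ⌊ w ≟ v ⌋) ws

Remainder : ∀ {n} → ℕ → ℕ → ColouredGraph n → List (Fin n × Fin n) → Subset n → Subset n
Remainder a b G ps Q =
  tabulate (λ v → not (inK₁ a b G v) ∧ not (inList (flat ps) v) ∧ not (lookup (ΓS G Q) v))

-- s = C log₂ n with C = c / e (rounded down to an integer).
sOf : ℕ → ℕ → ℕ → ℕ
sOf c e n = (c * ⌊log₂ n ⌋) / suc e

module Submission where

-- Call a vertex uncovered by Q if it lies outside K₁ ∪ K₂ ∪ Q ∪ Γ(Q), and a vertex of Γ_x \ (S ∪ Q)
-- available. By the maximality of K₂ every y ∉ K₁ ∪ K₂ has at least εn common neighbours with x, so
-- at least εn/(1+ε) available neighbours as long as |S ∪ Q| = O(log n). Double counting the edges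
-- between available and uncovered vertices gives an available v adjacent to an ε/(1+ε) fraction of
-- the uncovered ones, and adding v to Q divides their number by 1+ε. After log₂ n steps fewer than
-- n^(1-ε) vertices are uncovered, since (1+ε)^(1/ε) ≥ 9/4 > 2^(1+1/log₂ n) for ε ≤ 1/16 and n ≥ 64;
-- the remainder consists of these and of vertices of Q.

import Data.Nat.Properties as ℕₚ
open import Algebra.Properties.CommutativeSemigroup ℕₚ.*-commutativeSemigroup
  using (x∙yz≈y∙xz; x∙yz≈z∙yx; xy∙z≈y∙xz; x∙yz≈yx∙z; interchange)
open import Algebra.Properties.Semiring.Sum ℕₚ.+-*-semiring
  using (sum; ∑-distrib-+; ∑-comm; sum-cong-≗; *-distribˡ-sum)
open import Data.Bool using (Bool; true; false; not; _∧_; _∨_; T)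
open import Data.Bool.ListAction using (any)
open import Data.Bool.Properties using (T-∧; T-∨; ∧-idem)
open import Data.Empty using (⊥-elim)
open import Data.Fin using (Fin; zero; suc)
open import Data.Fin.Properties using (nonZeroIndex)
open import Data.Fin.Subset
  using (Subset; ∣_∣; _∩_; _∪_; _⊆_; Empty; ⁅_⁆; inside; outside)
  renaming (⊥ to ∅; _∈_ to _∈ₛ_; _∉_ to _∉ₛ_)
open import Data.Fin.Subset.Properties
  using (drop-∷-Empty; p⊆p∪q; q⊆p∪q; x∈⁅x⁆; x∈⁅y⁆⇒x≡y; ∣⁅x⁆∣≡1; x∈p∪q⁻; x∈p∩q⁺; x∈p∩q⁻;
         ∣⊥∣≡0; ⊆-min; ∉⊥)
open import Data.List using (List; allFin; _∷_)
import Data.List.Relation.Unary.Any as Any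
open import Data.List.Relation.Unary.Any.Properties using (any⁺; any⁻)
open import Data.List.Relation.Unary.All using (_∷_)
open import Data.List.Relation.Unary.All.Properties using (¬Any⇒All¬)
open import Data.List.Relation.Unary.AllPairs using (_∷_)
open import Data.List.Membership.Propositional using (_∉_; lose; find)
open import Data.List.Membership.Propositional.Properties using (∈-allFin)
open import Data.Maybe using (is-just)
open import Data.Nat
open import Data.Nat.Properties
open import Data.Nat.Combinatorics using (_C_; nC1≡n; nCk+nC[k+1]≡[n+1]C[k+1])
open import Data.Nat.DivMod using (_/_; _%_; m≡m%n+[m/n]*n; m%n<n; m/n≤m)
open import Data.Nat.Induction using (<-rec)
open import Data.Nat.Logarithm using (⌊log₂_⌋; ⌊log₂⌋-mono-≤; ⌊log₂[2^n]⌋≡n; ⌊log₂⌊n/2⌋⌋≡⌊log₂n⌋∸1)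
open import Data.Nat.Tactic.RingSolver using (solve-∀)
open import Data.Product using (_×_; _,_; ∃-syntax; proj₁; proj₂)
open import Data.Sum using (inj₁; inj₂)
import Data.Sum as Sum
open import Data.Vec using ([]; _∷_; lookup; tabulate; here)
open import Data.Vec.Properties using (lookup∘tabulate; lookup-zipWith; []=⇒lookup; lookup⇒[]=)
open import Function using (_∘_; id; Equivalence)
open import Relation.Binary.PropositionalEquality
open import Relation.Nullary using (¬_; yes; no)
open import Relation.Nullary.Decidable using (fromWitness)

open import Defs hiding (sym)

open Equivalence using (to; from)

-- Counting with indicators

𝟙 : Bool → ℕ
𝟙 true  = 1
𝟙 false = 0

count : ∀ {n} → (Fin n → Bool) → ℕ
count p = sum (𝟙 ∘ p)

𝟙≤1 : ∀ b → 𝟙 b ≤ 1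
𝟙≤1 true  = ≤-refl
𝟙≤1 false = z≤n

𝟙-∧ : ∀ p q → 𝟙 (p ∧ q) ≡ 𝟙 p * 𝟙 q
𝟙-∧ true  q = sym (+-identityʳ (𝟙 q))
𝟙-∧ false q = refl

𝟙[¬b′]+𝟙[¬b∧d]≤𝟙[¬b] : ∀ {b b′} d → (T b → T b′) → (T d → T b′) →
  𝟙 (not b′) + 𝟙 (not b ∧ d) ≤ 𝟙 (not b)
𝟙[¬b′]+𝟙[¬b∧d]≤𝟙[¬b] {true}  {true}  d     _    _    = z≤n
𝟙[¬b′]+𝟙[¬b∧d]≤𝟙[¬b] {false} {true}  d     _    _    = 𝟙≤1 d
𝟙[¬b′]+𝟙[¬b∧d]≤𝟙[¬b] {true}  {false} d     b⇒b′ _    = ⊥-elim (b⇒b′ _)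
𝟙[¬b′]+𝟙[¬b∧d]≤𝟙[¬b] {false} {false} true  _    d⇒b′ = ⊥-elim (d⇒b′ _)
𝟙[¬b′]+𝟙[¬b∧d]≤𝟙[¬b] {false} {false} false _    _    = ≤-refl

sum-mono-≤ : ∀ {n} {f g : Fin n → ℕ} → (∀ i → f i ≤ g i) → sum f ≤ sum g
sum-mono-≤ {zero}  f≤g = z≤n
sum-mono-≤ {suc n} f≤g = +-mono-≤ (f≤g zero) (sum-mono-≤ (f≤g ∘ suc))

sum-const : ∀ n c → sum {n} (λ _ → c) ≡ n * c
sum-const zero    c = refl
sum-const (suc n) c = cong (c +_) (sum-const n c)

count≤n : ∀ {n} (p : Fin n → Bool) → count p ≤ n
count≤n {n} p = begin
  count p            ≤⟨ sum-mono-≤ (𝟙≤1 ∘ p) ⟩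
  sum {n} (λ _ → 1)  ≡⟨ sum-const n 1 ⟩
  n * 1              ≡⟨ *-identityʳ n ⟩
  n                  ∎
  where open ≤-Reasoning

count>0⇒∃ : ∀ {n} (p : Fin n → Bool) → 0 < count p → ∃[ i ] T (p i)
count>0⇒∃ {suc n} p pos with p zero in eq
... | true  = zero , subst T (sym eq) _
... | false with count>0⇒∃ (p ∘ suc) pos
...   | i , pi = suc i , pi

m*𝟙p≤𝟙p*m′ : ∀ p {m m′} → (T p → m ≤ m′) → m * 𝟙 p ≤ 𝟙 p * m′
m*𝟙p≤𝟙p*m′ true  {m} {m′} m≤m′ = subst₂ _≤_ (sym (*-identityʳ m)) (sym (+-identityʳ m′)) (m≤m′ _)
m*𝟙p≤𝟙p*m′ false {m}      _    = ≤-reflexive (*-zeroʳ m)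

c≤𝟙p*m⇒T-p : ∀ p {c m} → 0 < c → c ≤ 𝟙 p * m → T p × c ≤ m
c≤𝟙p*m⇒T-p true  {m = m} _ c≤m = _ , subst (_ ≤_) (+-identityʳ m) c≤m
c≤𝟙p*m⇒T-p false (s≤s _) ()

∃≥average : ∀ {n} (f : Fin n → ℕ) {c} → 0 < n → n * c ≤ sum f → ∃[ i ] c ≤ f i
∃≥average {suc n} f {c} _ le with c ≤? f zero
... | yes c≤f₀ = zero , c≤f₀
∃≥average {suc zero}    f {c} _ le | no c≰f₀ =
  ⊥-elim (c≰f₀ (subst₂ _≤_ (+-identityʳ c) (+-identityʳ (f zero)) le))
∃≥average {suc (suc n)} f {c} _ le | no c≰f₀
  with ∃≥average (f ∘ suc) z<s (+-cancelˡ-≤ c _ _ (≤-trans le (+-monoˡ-≤ _ (<⇒≤ (≰⇒> c≰f₀)))))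
... | i , c≤fi = suc i , c≤fi

∣p∣≡count : ∀ {n} (p : Subset n) → ∣ p ∣ ≡ count (lookup p)
∣p∣≡count []            = refl
∣p∣≡count (outside ∷ p) = ∣p∣≡count p
∣p∣≡count (inside ∷ p)  = cong suc (∣p∣≡count p)

∣tabulate∣≡count : ∀ {n} (f : Fin n → Bool) → ∣ tabulate f ∣ ≡ count f
∣tabulate∣≡count f = trans (∣p∣≡count (tabulate f)) (sum-cong-≗ (cong 𝟙 ∘ lookup∘tabulate f))

∣p∪q∣≡∣p∣+∣q∣ : ∀ {n} (p q : Subset n) → Empty (p ∩ q) → ∣ p ∪ q ∣ ≡ ∣ p ∣ + ∣ q ∣
∣p∪q∣≡∣p∣+∣q∣ []            []            _ = refl
∣p∪q∣≡∣p∣+∣q∣ (outside ∷ p) (outside ∷ q) e = ∣p∪q∣≡∣p∣+∣q∣ p q (drop-∷-Empty e)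
∣p∪q∣≡∣p∣+∣q∣ (outside ∷ p) (inside ∷ q)  e =
  trans (cong suc (∣p∪q∣≡∣p∣+∣q∣ p q (drop-∷-Empty e))) (sym (+-suc ∣ p ∣ ∣ q ∣))
∣p∪q∣≡∣p∣+∣q∣ (inside ∷ p)  (outside ∷ q) e = cong suc (∣p∪q∣≡∣p∣+∣q∣ p q (drop-∷-Empty e))
∣p∪q∣≡∣p∣+∣q∣ (inside ∷ p)  (inside ∷ q)  e = ⊥-elim (e (zero , here))

∣p∪⁅x⁆∣≡1+∣p∣ : ∀ {n} {p : Subset n} {x} → x ∉ₛ p → ∣ p ∪ ⁅ x ⁆ ∣ ≡ suc ∣ p ∣
∣p∪⁅x⁆∣≡1+∣p∣ {p = p} {x} x∉p = begin
  ∣ p ∪ ⁅ x ⁆ ∣        ≡⟨ ∣p∪q∣≡∣p∣+∣q∣ p ⁅ x ⁆ disjoint ⟩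
  ∣ p ∣ + ∣ ⁅ x ⁆ ∣    ≡⟨ cong (∣ p ∣ +_) (∣⁅x⁆∣≡1 x) ⟩
  ∣ p ∣ + 1            ≡⟨ +-comm ∣ p ∣ 1 ⟩
  suc ∣ p ∣            ∎
  where
  open ≡-Reasoning
  disjoint : Empty (p ∩ ⁅ x ⁆)
  disjoint (y , y∈p∩⁅x⁆) with x∈p∩q⁻ p ⁅ x ⁆ y∈p∩⁅x⁆
  ... | y∈p , y∈⁅x⁆ = x∉p (subst (_∈ₛ p) (x∈⁅y⁆⇒x≡y x y∈⁅x⁆) y∈p)

p∪⁅x⁆⊆q : ∀ {n} {p q : Subset n} {x} → p ⊆ q → x ∈ₛ q → p ∪ ⁅ x ⁆ ⊆ q
p∪⁅x⁆⊆q {p = p} {q} {x} p⊆q x∈q {y} y∈p∪⁅x⁆ with x∈p∪q⁻ p ⁅ x ⁆ y∈p∪⁅x⁆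
... | inj₁ y∈p    = p⊆q y∈p
... | inj₂ y∈⁅x⁆ = subst (_∈ₛ q) (sym (x∈⁅y⁆⇒x≡y x y∈⁅x⁆)) x∈q

Empty[p∩q]⇒Empty[[p∪⁅x⁆]∩q] : ∀ {n} {p q : Subset n} {x} → Empty (p ∩ q) → x ∉ₛ q → Empty ((p ∪ ⁅ x ⁆) ∩ q)
Empty[p∩q]⇒Empty[[p∪⁅x⁆]∩q] {p = p} {q} {x} p∩q≡∅ x∉q (y , y∈) with x∈p∩q⁻ (p ∪ ⁅ x ⁆) q y∈
... | y∈p∪⁅x⁆ , y∈q with x∈p∪q⁻ p ⁅ x ⁆ y∈p∪⁅x⁆
...   | inj₁ y∈p    = p∩q≡∅ (y , x∈p∩q⁺ (y∈p , y∈q))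
...   | inj₂ y∈⁅x⁆ = x∉q (subst (_∈ₛ q) (x∈⁅y⁆⇒x≡y x y∈⁅x⁆) y∈q)

<ᵇ≡false⇒≥ : ∀ {m n} → (m <ᵇ n) ≡ false → n ≤ m
<ᵇ≡false⇒≥ m<ᵇn≡false = ≮⇒≥ (subst T m<ᵇn≡false ∘ <⇒<ᵇ)

T-∨ʳ : ∀ x {y} → T y → T (x ∨ y)
T-∨ʳ true  _ = _
T-∨ʳ false t = t

T-not⇒¬T : ∀ {b} → T (not b) → ¬ T b
T-not⇒¬T {false} _ ()

T-lookup⁺ : ∀ {n} {Q : Subset n} {w} → w ∈ₛ Q → T (lookup Q w)
T-lookup⁺ {Q = Q} {w} w∈Q = subst T (sym ([]=⇒lookup w∈Q)) _

T-lookup⁻ : ∀ {n} {Q : Subset n} {w} → T (lookup Q w) → w ∈ₛ Q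
T-lookup⁻ {Q = Q} {w} t with lookup Q w in eq
... | true = lookup⇒[]= w Q eq

inList≡false⇒∉ : ∀ {n} {ws : List (Fin n)} {v} → inList ws v ≡ false → v ∉ ws
inList≡false⇒∉ {v = v} eq v∈ws =
  subst T eq (any⁺ _ (Any.map (λ { refl → fromWitness {a? = v Data.Fin.≟ v} refl }) v∈ws))

-- Elementary estimates

^-distribʳ-* : ∀ m n p → (m * n) ^ p ≡ m ^ p * n ^ p
^-distribʳ-* m n zero    = refl
^-distribʳ-* m n (suc p) = begin
  m * n * (m * n) ^ p      ≡⟨ cong (m * n *_) (^-distribʳ-* m n p) ⟩
  m * n * (m ^ p * n ^ p)  ≡⟨ interchange m n (m ^ p) (n ^ p) ⟩
  m * m ^ p * (n * n ^ p)  ∎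
  where open ≡-Reasoning

^-comm-exponents : ∀ x k b → (x ^ k) ^ b ≡ (x ^ b) ^ k
^-comm-exponents x k b =
  trans (^-*-assoc x k b) (trans (cong (x ^_) (*-comm k b)) (sym (^-*-assoc x b k)))

[1+q]C2≡q+qC2 : ∀ q → suc q C 2 ≡ q + q C 2
[1+q]C2≡q+qC2 q = sym (trans (cong (_+ q C 2) (sym (nC1≡n q))) (nCk+nC[k+1]≡[n+1]C[k+1] q 1))

2*qC2+q≡q*q : ∀ q → 2 * (q C 2) + q ≡ q * q
2*qC2+q≡q*q zero    = refl
2*qC2+q≡q*q (suc q) = begin
  2 * (suc q C 2) + suc q      ≡⟨ cong (λ t → 2 * t + suc q) ([1+q]C2≡q+qC2 q) ⟩
  2 * (q + q C 2) + suc q      ≡⟨ regroup q (q C 2) ⟩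
  (2 * (q C 2) + q) + 2 * q + 1  ≡⟨ cong (λ t → t + 2 * q + 1) (2*qC2+q≡q*q q) ⟩
  q * q + 2 * q + 1            ≡⟨ square q ⟩
  suc q * suc q                ∎
  where
  open ≡-Reasoning
  regroup : ∀ q t → 2 * (q + t) + suc q ≡ (2 * t + q) + 2 * q + 1
  regroup = solve-∀
  square : ∀ q → q * q + 2 * q + 1 ≡ suc q * suc q
  square = solve-∀

-- (1 + a/b)^m ≥ 1 + m (a/b) + (m C 2) (a/b)², multiplied through by b^(m+2).
bernoulli₂ : ∀ a b m →
  b ^ m * (b * b + m * a * b + (m C 2) * (a * a)) ≤ b * b * (a + b) ^ m
bernoulli₂ a b zero    = ≤-reflexive (base b)
  where
  base : ∀ b → 1 * (b * b + 0 * a * b + 0 * (a * a)) ≡ b * b * 1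
  base = solve-∀
bernoulli₂ a b (suc m) = begin
  b ^ suc m * (b * b + suc m * a * b + (suc m C 2) * (a * a))
    ≡⟨ cong (λ t → b ^ suc m * (b * b + suc m * a * b + t * (a * a))) ([1+q]C2≡q+qC2 m) ⟩
  b ^ suc m * (b * b + suc m * a * b + (m + m C 2) * (a * a))
    ≡⟨ xy∙z≈y∙xz b (b ^ m) _ ⟩
  b ^ m * (b * (b * b + suc m * a * b + (m + m C 2) * (a * a)))
    ≤⟨ *-monoʳ-≤ (b ^ m) (m≤m+n _ _) ⟩
  b ^ m * (b * (b * b + suc m * a * b + (m + m C 2) * (a * a)) + (m C 2) * (a * (a * a)))
    ≡⟨ cong (b ^ m *_) (step a b m (m C 2)) ⟩
  b ^ m * ((a + b) * (b * b + m * a * b + (m C 2) * (a * a)))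
    ≡⟨ x∙yz≈y∙xz (b ^ m) (a + b) _ ⟩
  (a + b) * (b ^ m * (b * b + m * a * b + (m C 2) * (a * a)))
    ≤⟨ *-monoʳ-≤ (a + b) (bernoulli₂ a b m) ⟩
  (a + b) * (b * b * (a + b) ^ m)
    ≡⟨ x∙yz≈y∙xz (a + b) (b * b) _ ⟩
  b * b * (a + b) ^ suc m ∎
  where
  open ≤-Reasoning
  step : ∀ a b m t → b * (b * b + (1 + m) * a * b + (m + t) * (a * a)) + t * (a * (a * a))
                   ≡ (a + b) * (b * b + m * a * b + t * (a * a))
  step = solve-∀

-- With 2 (q C 2) = q² - q this reduces to 6qar + 5r² + 2qa² ≤ q²a², true as r ≤ a and q ≥ 13.
9b²≤4[b²+qab+qC2a²] : ∀ a q r → r ≤ a → 13 ≤ q → let b = q * a + r in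
  9 * (b * b) ≤ 4 * (b * b + q * a * b + (q C 2) * (a * a))
9b²≤4[b²+qab+qC2a²] a q r r≤a 13≤q =
  +-cancelʳ-≤ (2 * (q * (a * a))) _ _ (+-cancelʳ-≤ (q * q * (a * a)) _ _ (begin
    9 * (b * b) + 2 * (q * (a * a)) + q * q * (a * a)
      ≡⟨ split a q r ⟩
    (4 * (b * b) + 4 * q * a * b + 2 * (q * q) * (a * a)) + (6 * (q * a * r) + 5 * (r * r) + 2 * (q * (a * a)))
      ≤⟨ +-monoʳ-≤ _ small ⟩
    (4 * (b * b) + 4 * q * a * b + 2 * (q * q) * (a * a)) + q * q * (a * a)
      ≡⟨ cong (λ t → 4 * (b * b) + 4 * q * a * b + 2 * t * (a * a) + q * q * (a * a)) (sym (2*qC2+q≡q*q q)) ⟩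
    (4 * (b * b) + 4 * q * a * b + 2 * (2 * (q C 2) + q) * (a * a)) + q * q * (a * a)
      ≡⟨ cong (_+ q * q * (a * a)) (regroup (b * b) q a b (q C 2)) ⟩
    4 * (b * b + q * a * b + (q C 2) * (a * a)) + 2 * (q * (a * a)) + q * q * (a * a) ∎))
  where
  open ≤-Reasoning
  b = q * a + r
  q≢0 : NonZero q
  q≢0 = >-nonZero (≤-trans (s≤s z≤n) 13≤q)
  split : ∀ a q r → let b = q * a + r in
    9 * (b * b) + 2 * (q * (a * a)) + q * q * (a * a) ≡
    (4 * (b * b) + 4 * q * a * b + 2 * (q * q) * (a * a)) + (6 * (q * a * r) + 5 * (r * r) + 2 * (q * (a * a)))
  split = solve-∀
  regroup : ∀ x q a b c → 4 * x + 4 * q * a * b + 2 * (2 * c + q) * (a * a) ≡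
                          4 * (x + q * a * b + c * (a * a)) + 2 * (q * (a * a))
  regroup = solve-∀
  small : 6 * (q * a * r) + 5 * (r * r) + 2 * (q * (a * a)) ≤ q * q * (a * a)
  small = begin
    6 * (q * a * r) + 5 * (r * r) + 2 * (q * (a * a))
      ≤⟨ +-monoˡ-≤ _ (+-mono-≤ (*-monoʳ-≤ 6 qar≤qa²) (*-monoʳ-≤ 5 r²≤qa²)) ⟩
    6 * (q * (a * a)) + 5 * (q * (a * a)) + 2 * (q * (a * a))
      ≡⟨ thirteen (q * (a * a)) ⟩
    13 * (q * (a * a))
      ≤⟨ *-monoˡ-≤ _ 13≤q ⟩
    q * (q * (a * a))
      ≡⟨ sym (*-assoc q q _) ⟩
    q * q * (a * a) ∎
    where
    qar≤qa² : q * a * r ≤ q * (a * a)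
    qar≤qa² = ≤-trans (≤-reflexive (*-assoc q a r)) (*-monoʳ-≤ q (*-monoʳ-≤ a r≤a))
    r²≤qa² : r * r ≤ q * (a * a)
    r²≤qa² = ≤-trans (*-mono-≤ r≤a r≤a) (m≤n*m (a * a) q {{q≢0}})
    thirteen : ∀ x → 6 * x + 5 * x + 2 * x ≡ 13 * x
    thirteen = solve-∀

9b^q≤4[a+b]^q : ∀ a q r → 0 < a → r ≤ a → 13 ≤ q → let b = q * a + r in
  9 * b ^ q ≤ 4 * (a + b) ^ q
9b^q≤4[a+b]^q a q r a>0 r≤a 13≤q = *-cancelˡ-≤ (b * b) {{b²≢0}} (begin
  b * b * (9 * b ^ q)                                ≡⟨ x∙yz≈z∙yx (b * b) 9 (b ^ q) ⟩
  b ^ q * (9 * (b * b))                              ≤⟨ *-monoʳ-≤ (b ^ q) (9b²≤4[b²+qab+qC2a²] a q r r≤a 13≤q) ⟩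
  b ^ q * (4 * (b * b + q * a * b + (q C 2) * (a * a)))  ≡⟨ x∙yz≈y∙xz (b ^ q) 4 _ ⟩
  4 * (b ^ q * (b * b + q * a * b + (q C 2) * (a * a)))  ≤⟨ *-monoʳ-≤ 4 (bernoulli₂ a b q) ⟩
  4 * (b * b * (a + b) ^ q)                          ≡⟨ x∙yz≈y∙xz 4 (b * b) _ ⟩
  b * b * (4 * (a + b) ^ q)                          ∎)
  where
  open ≤-Reasoning
  b = q * a + r
  b²≢0 : NonZero (b * b)
  b²≢0 = >-nonZero (*-mono-< b>0 b>0)
    where
    b>0 : 0 < b
    b>0 = ≤-trans (≤-trans a>0 (m≤n*m a q {{>-nonZero (≤-trans (s≤s z≤n) 13≤q)}})) (m≤m+n (q * a) r)

-- (1 + ε)^(1/ε) ≥ 9/4 for ε = a/b ≤ 1/16.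
9^a*b^b≤4^a*[a+b]^b : ∀ a b → 0 < a → 16 * a ≤ b → 9 ^ a * b ^ b ≤ 4 ^ a * (a + b) ^ b
9^a*b^b≤4^a*[a+b]^b a@(suc _) b a>0 16a≤b =
  subst (λ z → 9 ^ a * z ^ z ≤ 4 ^ a * (a + z) ^ z) (sym b≡qa+r) (begin
    9 ^ a * c ^ (q * a + r)                    ≡⟨ cong (9 ^ a *_) (^-distribˡ-+-* c (q * a) r) ⟩
    9 ^ a * (c ^ (q * a) * c ^ r)              ≡⟨ sym (*-assoc (9 ^ a) _ _) ⟩
    9 ^ a * c ^ (q * a) * c ^ r                ≤⟨ *-mono-≤ blocks (^-monoˡ-≤ r (m≤n+m c a)) ⟩
    4 ^ a * (a + c) ^ (q * a) * (a + c) ^ r    ≡⟨ *-assoc (4 ^ a) _ _ ⟩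
    4 ^ a * ((a + c) ^ (q * a) * (a + c) ^ r)  ≡⟨ cong (4 ^ a *_) (sym (^-distribˡ-+-* (a + c) (q * a) r)) ⟩
    4 ^ a * (a + c) ^ (q * a + r)              ∎)
  where
  open ≤-Reasoning
  q = b / a
  r = b % a
  c = q * a + r
  b≡qa+r : b ≡ q * a + r
  b≡qa+r = trans (m≡m%n+[m/n]*n b a) (+-comm r (q * a))
  13≤q : 13 ≤ q
  13≤q with 13 ≤? q
  ... | yes 13≤q = 13≤q
  ... | no  13≰q = ⊥-elim (<⇒≱ b<16a 16a≤b)
    where
    b<16a : b < 16 * a
    b<16a = begin-strict
      b          ≡⟨ b≡qa+r ⟩
      q * a + r  <⟨ +-monoʳ-< (q * a) (m%n<n b a) ⟩
      q * a + a  ≡⟨ +-comm (q * a) a ⟩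
      suc q * a  ≤⟨ *-monoˡ-≤ a (≤-trans (≰⇒> 13≰q) (m≤m+n 13 3)) ⟩
      16 * a     ∎
  blocks : 9 ^ a * c ^ (q * a) ≤ 4 ^ a * (a + c) ^ (q * a)
  blocks = begin
    9 ^ a * c ^ (q * a)          ≡⟨ cong (9 ^ a *_) (sym (^-*-assoc c q a)) ⟩
    9 ^ a * (c ^ q) ^ a          ≡⟨ sym (^-distribʳ-* 9 (c ^ q) a) ⟩
    (9 * c ^ q) ^ a              ≤⟨ ^-monoˡ-≤ a (9b^q≤4[a+b]^q a q r a>0 (<⇒≤ (m%n<n b a)) 13≤q) ⟩
    (4 * (a + c) ^ q) ^ a        ≡⟨ ^-distribʳ-* 4 ((a + c) ^ q) a ⟩
    4 ^ a * ((a + c) ^ q) ^ a    ≡⟨ cong (4 ^ a *_) (^-*-assoc (a + c) q a) ⟩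
    4 ^ a * (a + c) ^ (q * a)    ∎

2*8^k≤9^k : ∀ {k} → 6 ≤ k → 2 * 8 ^ k ≤ 9 ^ k
2*8^k≤9^k = go ∘ ≤⇒≤′
  where
  go : ∀ {k} → 6 ≤′ k → 2 * 8 ^ k ≤ 9 ^ k
  go (≤′-reflexive refl) = ≤ᵇ⇒≤ (2 * 8 ^ 6) (9 ^ 6) _
  go {suc k} (≤′-step 6≤′k) = begin
    2 * (8 * 8 ^ k)  ≡⟨ x∙yz≈y∙xz 2 8 (8 ^ k) ⟩
    8 * (2 * 8 ^ k)  ≤⟨ *-monoʳ-≤ 8 (go 6≤′k) ⟩
    8 * 9 ^ k        ≤⟨ *-monoˡ-≤ (9 ^ k) (n≤1+n 8) ⟩
    9 * 9 ^ k        ∎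
    where
    open ≤-Reasoning

k*k<2^k : ∀ {k} → 5 ≤ k → k * k < 2 ^ k
k*k<2^k = go ∘ ≤⇒≤′
  where
  go : ∀ {k} → 5 ≤′ k → k * k < 2 ^ k
  go (≤′-reflexive refl) = ≤ᵇ⇒≤ 26 32 _
  go {suc k} (≤′-step 5≤′k) = begin-strict
    suc k * suc k      ≡⟨ square k ⟩
    k * k + (2 * k + 1)  ≤⟨ +-monoʳ-≤ (k * k) 2k+1≤k² ⟩
    k * k + k * k      <⟨ +-mono-< (go 5≤′k) (go 5≤′k) ⟩
    2 ^ k + 2 ^ k      ≡⟨ cong (2 ^ k +_) (sym (+-identityʳ (2 ^ k))) ⟩
    2 * 2 ^ k          ∎
    where
    open ≤-Reasoning
    5≤k : 5 ≤ k
    5≤k = ≤′⇒≤ 5≤′k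
    square : ∀ k → suc k * suc k ≡ k * k + (2 * k + 1)
    square = solve-∀
    2k+1≤k² : 2 * k + 1 ≤ k * k
    2k+1≤k² = begin
      2 * k + 1  ≤⟨ +-monoʳ-≤ (2 * k) (≤-trans (s≤s z≤n) 5≤k) ⟩
      2 * k + k  ≡⟨ +-comm (2 * k) k ⟩
      3 * k      ≤⟨ *-monoˡ-≤ k (≤-trans (s≤s (s≤s (s≤s z≤n))) 5≤k) ⟩
      k * k      ∎

n<2^[1+⌊log₂n⌋] : ∀ n → n < 2 ^ suc ⌊log₂ n ⌋
n<2^[1+⌊log₂n⌋] n = ≰⇒> λ 2^[1+k]≤n →
  <-irrefl refl (≤-trans (≤-reflexive (sym (⌊log₂[2^n]⌋≡n (suc ⌊log₂ n ⌋)))) (⌊log₂⌋-mono-≤ 2^[1+k]≤n))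

2^⌊log₂n⌋≤n : ∀ n → 0 < n → 2 ^ ⌊log₂ n ⌋ ≤ n
2^⌊log₂n⌋≤n = <-rec (λ n → 0 < n → 2 ^ ⌊log₂ n ⌋ ≤ n) go
  where
  go : ∀ n → (∀ {m} → m < n → 0 < m → 2 ^ ⌊log₂ m ⌋ ≤ m) → 0 < n → 2 ^ ⌊log₂ n ⌋ ≤ n
  go 1                ih _ = ≤-refl
  go n@(suc (suc n′)) ih _ = begin
    2 ^ ⌊log₂ n ⌋                ≡⟨ cong (2 ^_) (sym halve) ⟩
    2 * 2 ^ ⌊log₂ ⌊ n /2⌋ ⌋      ≤⟨ *-monoʳ-≤ 2 (ih (⌊n/2⌋<n (suc n′)) z<s) ⟩
    2 * ⌊ n /2⌋                  ≡⟨ cong (⌊ n /2⌋ +_) (+-identityʳ ⌊ n /2⌋) ⟩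
    ⌊ n /2⌋ + ⌊ n /2⌋            ≤⟨ +-monoʳ-≤ ⌊ n /2⌋ (⌊n/2⌋≤⌈n/2⌉ n) ⟩
    ⌊ n /2⌋ + ⌈ n /2⌉            ≡⟨ ⌊n/2⌋+⌈n/2⌉≡n n ⟩
    n                            ∎
    where
    open ≤-Reasoning
    1≤⌊log₂n⌋ : 1 ≤ ⌊log₂ n ⌋
    1≤⌊log₂n⌋ = ⌊log₂⌋-mono-≤ {2} {n} (s≤s (s≤s z≤n))
    halve : suc ⌊log₂ ⌊ n /2⌋ ⌋ ≡ ⌊log₂ n ⌋
    halve = trans (cong suc (⌊log₂⌊n/2⌋⌋≡⌊log₂n⌋∸1 n)) (m+[n∸m]≡n 1≤⌊log₂n⌋)

-- Raise (1 + a/b)^b ≥ (9/4)^a to the k-th power and use 9^k ≥ 2 · 8^k = 2^(k+1) · 4^k.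
2^[[1+k]a]*b^[bk]≤[a+b]^[bk] : ∀ {a b k} → 0 < a → 16 * a ≤ b → 6 ≤ k →
  (2 ^ suc k) ^ a * (b ^ b) ^ k ≤ ((a + b) ^ b) ^ k
2^[[1+k]a]*b^[bk]≤[a+b]^[bk] {a} {b} {k} a>0 16a≤b 6≤k = *-cancelˡ-≤ (β ^ a) {{m^n≢0 β a {{m^n≢0 4 k}}}} (begin
  β ^ a * (α ^ a * V ^ k)    ≡⟨ x∙yz≈yx∙z (β ^ a) (α ^ a) (V ^ k) ⟩
  α ^ a * β ^ a * V ^ k      ≡⟨ cong (_* V ^ k) (sym (^-distribʳ-* α β a)) ⟩
  (α * β) ^ a * V ^ k        ≤⟨ *-monoˡ-≤ (V ^ k) (^-monoˡ-≤ a αβ≤γ) ⟩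
  γ ^ a * V ^ k              ≡⟨ cong (_* V ^ k) (^-comm-exponents 9 k a) ⟩
  (9 ^ a) ^ k * V ^ k        ≡⟨ sym (^-distribʳ-* (9 ^ a) V k) ⟩
  (9 ^ a * V) ^ k            ≤⟨ ^-monoˡ-≤ k (9^a*b^b≤4^a*[a+b]^b a b a>0 16a≤b) ⟩
  (4 ^ a * W) ^ k            ≡⟨ ^-distribʳ-* (4 ^ a) W k ⟩
  (4 ^ a) ^ k * W ^ k        ≡⟨ cong (_* W ^ k) (^-comm-exponents 4 a k) ⟩
  β ^ a * W ^ k              ∎)
  where
  open ≤-Reasoning
  α = 2 ^ suc k
  β = 4 ^ k
  γ = 9 ^ k
  V = b ^ b
  W = (a + b) ^ b
  αβ≤γ : α * β ≤ γ
  αβ≤γ = begin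
    2 * 2 ^ k * 4 ^ k    ≡⟨ *-assoc 2 (2 ^ k) β ⟩
    2 * (2 ^ k * 4 ^ k)  ≡⟨ cong (2 *_) (sym (^-distribʳ-* 2 4 k)) ⟩
    2 * 8 ^ k            ≤⟨ 2*8^k≤9^k 6≤k ⟩
    9 ^ k                ∎

decay⇒u^b<n^[b∸a] : ∀ {a b k n u} → 0 < a → 16 * a ≤ b → 6 ≤ k → 0 < n → n < 2 ^ suc k →
  (a + b) ^ k * u ≤ b ^ k * n → u ^ b < n ^ (b ∸ a)
decay⇒u^b<n^[b∸a] {a} {b} {k} {n} {u} a>0 16a≤b 6≤k n>0 n<2^[1+k] decay =
  *-cancelˡ-< (W ^ k) (u ^ b) (n ^ (b ∸ a)) (begin-strict
    W ^ k * u ^ b                  ≡⟨ cong (_* u ^ b) (sym (^-comm-exponents (a + b) k b)) ⟩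
    ((a + b) ^ k) ^ b * u ^ b      ≡⟨ sym (^-distribʳ-* ((a + b) ^ k) u b) ⟩
    ((a + b) ^ k * u) ^ b          ≤⟨ ^-monoˡ-≤ b decay ⟩
    (b ^ k * n) ^ b                ≡⟨ ^-distribʳ-* (b ^ k) n b ⟩
    (b ^ k) ^ b * n ^ b            ≡⟨ cong₂ _*_ (^-comm-exponents b k b) (cong (n ^_) (sym (m+[n∸m]≡n a≤b))) ⟩
    V ^ k * n ^ (a + (b ∸ a))      ≡⟨ cong (V ^ k *_) (^-distribˡ-+-* n a (b ∸ a)) ⟩
    V ^ k * (n ^ a * n ^ (b ∸ a))  ≡⟨ sym (*-assoc (V ^ k) (n ^ a) _) ⟩
    V ^ k * n ^ a * n ^ (b ∸ a)    <⟨ *-monoˡ-< (n ^ (b ∸ a)) {{n^[b∸a]≢0}} (*-monoʳ-< (V ^ k) {{V^k≢0}} n^a<α^a) ⟩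
    V ^ k * α ^ a * n ^ (b ∸ a)    ≡⟨ cong (_* n ^ (b ∸ a)) (*-comm (V ^ k) (α ^ a)) ⟩
    α ^ a * V ^ k * n ^ (b ∸ a)    ≤⟨ *-monoˡ-≤ (n ^ (b ∸ a)) (2^[[1+k]a]*b^[bk]≤[a+b]^[bk] a>0 16a≤b 6≤k) ⟩
    W ^ k * n ^ (b ∸ a)            ∎)
  where
  open ≤-Reasoning
  α = 2 ^ suc k
  V = b ^ b
  W = (a + b) ^ b
  a≤b : a ≤ b
  a≤b = ≤-trans (m≤n*m a 16) 16a≤b
  n^a<α^a : n ^ a < α ^ a
  n^a<α^a = ^-monoˡ-< a {{>-nonZero a>0}} n<2^[1+k]
  n^[b∸a]≢0 : NonZero (n ^ (b ∸ a))
  n^[b∸a]≢0 = m^n≢0 n (b ∸ a) {{>-nonZero n>0}}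
  V^k≢0 : NonZero (V ^ k)
  V^k≢0 = m^n≢0 V k {{m^n≢0 b b {{>-nonZero (≤-trans a>0 a≤b)}}}}

k^b<n^[b∸a] : ∀ {a b k n} → 0 < b → 2 * a ≤ b → k * k < n → k ^ b < n ^ (b ∸ a)
k^b<n^[b∸a] {a} {b} {k} {n} b>0 2a≤b k²<n with k ^ b <? n ^ (b ∸ a)
... | yes k^b<n^[b∸a] = k^b<n^[b∸a]
... | no  k^b≮n^[b∸a] = ⊥-elim (<-irrefl refl (begin-strict
  n ^ (b ∸ a) * n ^ (b ∸ a)  ≤⟨ *-mono-≤ (≮⇒≥ k^b≮n^[b∸a]) (≮⇒≥ k^b≮n^[b∸a]) ⟩
  k ^ b * k ^ b              ≡⟨ sym (^-distribʳ-* k k b) ⟩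
  (k * k) ^ b                <⟨ ^-monoˡ-< b {{>-nonZero b>0}} k²<n ⟩
  n ^ b                      ≤⟨ ^-monoʳ-≤ n {{>-nonZero (≤-<-trans z≤n k²<n)}} b≤2[b∸a] ⟩
  n ^ ((b ∸ a) + (b ∸ a))    ≡⟨ ^-distribˡ-+-* n (b ∸ a) (b ∸ a) ⟩
  n ^ (b ∸ a) * n ^ (b ∸ a)  ∎))
  where
  open ≤-Reasoning
  a+a≤b : a + a ≤ b
  a+a≤b = subst (_≤ b) (cong (a +_) (+-identityʳ a)) 2a≤b
  b≤2[b∸a] : b ≤ (b ∸ a) + (b ∸ a)
  b≤2[b∸a] = begin
    b                    ≡⟨ sym (m+[n∸m]≡n (≤-trans (m≤m+n a a) a+a≤b)) ⟩
    a + (b ∸ a)          ≤⟨ +-monoˡ-≤ (b ∸ a) (m+n≤o⇒m≤o∸n a a+a≤b) ⟩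
    (b ∸ a) + (b ∸ a)    ∎

u+k<2n^[1-ε] : ∀ {a b k n u} → 0 < a → 16 * a ≤ b → 6 ≤ k → 2 ^ k ≤ n → n < 2 ^ suc k →
  (a + b) ^ k * u ≤ b ^ k * n → (u + k) ^ b < 2 ^ b * n ^ (b ∸ a)
u+k<2n^[1-ε] {a} {b} {k} {n} {u} a>0 16a≤b 6≤k 2^k≤n n<2^[1+k] decay = begin-strict
  (u + k) ^ b        ≤⟨ ^-monoˡ-≤ b (+-mono-≤ (m≤m⊔n u k) (m≤n⊔m u k)) ⟩
  (m + m) ^ b        ≡⟨ cong (λ t → (m + t) ^ b) (sym (+-identityʳ m)) ⟩
  (2 * m) ^ b        ≡⟨ ^-distribʳ-* 2 m b ⟩
  2 ^ b * m ^ b      <⟨ *-monoʳ-< (2 ^ b) {{m^n≢0 2 b}} m^b<n^[b∸a] ⟩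
  2 ^ b * n ^ (b ∸ a) ∎
  where
  open ≤-Reasoning
  m = u ⊔ k
  b>0 : 0 < b
  b>0 = ≤-trans a>0 (≤-trans (m≤n*m a 16) 16a≤b)
  2a≤b : 2 * a ≤ b
  2a≤b = ≤-trans (*-monoˡ-≤ a (m≤m+n 2 14)) 16a≤b
  n>0 : 0 < n
  n>0 = ≤-trans (m^n>0 2 k) 2^k≤n
  k²<n : k * k < n
  k²<n = <-≤-trans (k*k<2^k (≤-trans (n≤1+n 5) 6≤k)) 2^k≤n
  m^b<n^[b∸a] : m ^ b < n ^ (b ∸ a)
  m^b<n^[b∸a] with ⊔-sel u k
  ... | inj₁ m≡u = subst (λ t → t ^ b < n ^ (b ∸ a)) (sym m≡u)
                     (decay⇒u^b<n^[b∸a] a>0 16a≤b 6≤k n>0 n<2^[1+k] decay)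
  ... | inj₂ m≡k = subst (λ t → t ^ b < n ^ (b ∸ a)) (sym m≡k) (k^b<n^[b∸a] {a} b>0 2a≤b k²<n)

K*k≤n : ∀ {K k n} → K * K ≤ n → k * k ≤ n → K * k ≤ n
K*k≤n {K} {k} K²≤n k²≤n with ≤-total K k
... | inj₁ K≤k = ≤-trans (*-monoˡ-≤ k K≤k) k²≤n
... | inj₂ k≤K = ≤-trans (*-monoʳ-≤ K k≤K) K²≤n

-- With ε = a/b: g ≥ εn, g ≤ h + t and t ≤ n/(b(a+b)) ≤ ε²n/(1+ε) give h ≥ εn/(1+ε).
a*n≤[a+b]*h : ∀ {a b n g h t} → 0 < a → 0 < b → a * n ≤ b * g → g ≤ h + t → b * (a + b) * t ≤ n →
  a * n ≤ (a + b) * h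
a*n≤[a+b]*h {a} {b} {n} {g} {h} {t} a>0 b>0 an≤bg g≤h+t room =
  *-cancelˡ-≤ b {{>-nonZero b>0}} (+-cancelˡ-≤ (a * (a * n)) _ _ (begin
    a * (a * n) + b * (a * n)        ≤⟨ +-mono-≤ (*-monoʳ-≤ a an≤bg) (*-monoʳ-≤ b an≤bg) ⟩
    a * (b * g) + b * (b * g)        ≡⟨ collect a b g ⟩
    b * (a + b) * g                  ≤⟨ *-monoʳ-≤ (b * (a + b)) g≤h+t ⟩
    b * (a + b) * (h + t)            ≡⟨ expand a b h t ⟩
    b * (a + b) * t + b * ((a + b) * h)  ≤⟨ +-monoˡ-≤ _ (≤-trans room n≤a*[a*n]) ⟩
    a * (a * n) + b * ((a + b) * h)  ∎))
  where
  open ≤-Reasoning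
  n≤a*[a*n] : n ≤ a * (a * n)
  n≤a*[a*n] = ≤-trans (m≤n*m n a {{>-nonZero a>0}}) (m≤n*m (a * n) a {{>-nonZero a>0}})
  collect : ∀ a b g → a * (b * g) + b * (b * g) ≡ b * (a + b) * g
  collect = solve-∀
  expand : ∀ a b h t → b * (a + b) * (h + t) ≡ b * (a + b) * t + b * ((a + b) * h)
  expand = solve-∀

[a+b]*u′≤b*u : ∀ {a b u u′ g} → u′ + g ≤ u → a * u ≤ (a + b) * g → (a + b) * u′ ≤ b * u
[a+b]*u′≤b*u {a} {b} {u} {u′} {g} u′+g≤u au≤[a+b]g = +-cancelˡ-≤ (a * u) _ _ (begin
  a * u + (a + b) * u′        ≤⟨ +-monoˡ-≤ _ au≤[a+b]g ⟩
  (a + b) * g + (a + b) * u′  ≡⟨ sym (*-distribˡ-+ (a + b) g u′) ⟩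
  (a + b) * (g + u′)          ≤⟨ *-monoʳ-≤ (a + b) (≤-trans (≤-reflexive (+-comm g u′)) u′+g≤u) ⟩
  (a + b) * u                 ≡⟨ *-distribʳ-+ u a b ⟩
  a * u + b * u               ∎)
  where open ≤-Reasoning

c^[1+i]*u′≤b^[1+i]*n : ∀ {c b i u u′ n} → c * u′ ≤ b * u → c ^ i * u ≤ b ^ i * n →
  c ^ suc i * u′ ≤ b ^ suc i * n
c^[1+i]*u′≤b^[1+i]*n {c} {b} {i} {u} {u′} {n} cu′≤bu c^iu≤b^in = begin
  c * c ^ i * u′    ≡⟨ xy∙z≈y∙xz c (c ^ i) u′ ⟩
  c ^ i * (c * u′)  ≤⟨ *-monoʳ-≤ (c ^ i) cu′≤bu ⟩
  c ^ i * (b * u)   ≡⟨ x∙yz≈y∙xz (c ^ i) b u ⟩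
  b * (c ^ i * u)   ≤⟨ *-monoʳ-≤ b c^iu≤b^in ⟩
  b * (b ^ i * n)   ≡⟨ sym (*-assoc b (b ^ i) n) ⟩
  b * b ^ i * n     ∎
  where open ≤-Reasoning

-- The greedy covering

module Covering {n} (G : ColouredGraph n) where

  adj-sym : ∀ v y → adj G v y ≡ adj G y v
  adj-sym v y = cong is-just (ColouredGraph.sym G v y)

  covered : Subset n → Fin n → Bool
  covered Q y = any (λ w → lookup Q w ∧ adj G w y) (allFin n)

  covered⁺ : ∀ {Q w y} → w ∈ₛ Q → T (adj G w y) → T (covered Q y)
  covered⁺ {w = w} w∈Q wy = any⁺ _ (lose (∈-allFin w) (T-∧ .from (T-lookup⁺ w∈Q , wy)))

  covered-mono : ∀ {Q Q′ y} → Q ⊆ Q′ → T (covered Q y) → T (covered Q′ y)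
  covered-mono {Q} {y = y} Q⊆Q′ c with find (any⁻ _ (allFin n) c)
  ... | w , _ , Qw∧wy with T-∧ .to Qw∧wy
  ...   | Qw , wy = covered⁺ (Q⊆Q′ (T-lookup⁻ Qw)) wy

module Uncovered {n} (G : ColouredGraph n) (a b : ℕ) (ps : List (Fin n × Fin n)) where
  open Covering G

  blocked : Subset n → Fin n → Bool
  blocked Q y = inK₁ a b G y ∨ inList (flat ps) y ∨ lookup Q y ∨ covered Q y

  uncovered : Subset n → Fin n → Bool
  uncovered Q y = not (blocked Q y)

  gain : Subset n → Fin n → ℕ
  gain Q v = count (λ y → uncovered Q y ∧ adj G v y)

  blocked-mono : ∀ {Q Q′} y → Q ⊆ Q′ → T (blocked Q y) → T (blocked Q′ y)
  blocked-mono y Q⊆Q′ with inK₁ a b G y | inList (flat ps) y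
  ... | true  | _     = id
  ... | false | true  = id
  ... | false | false =
    T-∨ .from ∘ Sum.map (T-lookup⁺ ∘ Q⊆Q′ ∘ T-lookup⁻) (covered-mono Q⊆Q′) ∘ T-∨ .to

  adj⇒blocked : ∀ {Q v y} → v ∈ₛ Q → T (adj G v y) → T (blocked Q y)
  adj⇒blocked {Q} {v} {y} v∈Q vy =
    T-∨ʳ (inK₁ a b G y) (T-∨ʳ (inList (flat ps) y) (T-∨ʳ (lookup Q y) (covered⁺ v∈Q vy)))

  uncovered⇒∉K₁∪K₂ : ∀ {Q} y → T (uncovered Q y) → inK₁ a b G y ≡ false × y ∉ flat ps
  uncovered⇒∉K₁∪K₂ y t with inK₁ a b G y | inList (flat ps) y in k₂
  ... | false | false = refl , inList≡false⇒∉ k₂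

  count-uncovered-∪⁅⁆ : ∀ Q v → count (uncovered (Q ∪ ⁅ v ⁆)) + gain Q v ≤ count (uncovered Q)
  count-uncovered-∪⁅⁆ Q v = begin
    count (uncovered (Q ∪ ⁅ v ⁆)) + gain Q v
      ≡⟨ sym (∑-distrib-+ (𝟙 ∘ uncovered (Q ∪ ⁅ v ⁆)) _) ⟩
    sum (λ y → 𝟙 (uncovered (Q ∪ ⁅ v ⁆) y) + 𝟙 (uncovered Q y ∧ adj G v y))
      ≤⟨ sum-mono-≤ (λ y → 𝟙[¬b′]+𝟙[¬b∧d]≤𝟙[¬b] (adj G v y)
           (blocked-mono {Q} y (p⊆p∪q ⁅ v ⁆)) (adj⇒blocked (q⊆p∪q Q ⁅ v ⁆ (x∈⁅x⁆ v)))) ⟩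
    count (uncovered Q) ∎
    where open ≤-Reasoning

  ∣Remainder∣≤count-uncovered+∣Q∣ : ∀ Q → ∣ Remainder a b G ps Q ∣ ≤ count (uncovered Q) + ∣ Q ∣
  ∣Remainder∣≤count-uncovered+∣Q∣ Q = begin
    ∣ Remainder a b G ps Q ∣
      ≡⟨ ∣tabulate∣≡count remains ⟩
    count remains
      ≤⟨ sum-mono-≤ pointwise ⟩
    sum (λ v → 𝟙 (uncovered Q v) + 𝟙 (lookup Q v))
      ≡⟨ ∑-distrib-+ (𝟙 ∘ uncovered Q) (𝟙 ∘ lookup Q) ⟩
    count (uncovered Q) + count (lookup Q)
      ≡⟨ cong (count (uncovered Q) +_) (sym (∣p∣≡count Q)) ⟩
    count (uncovered Q) + ∣ Q ∣ ∎
    where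
    open ≤-Reasoning
    split : ∀ k₁ k₂ q c → 𝟙 (not k₁ ∧ not k₂ ∧ not (not q ∧ c)) ≤ 𝟙 (not (k₁ ∨ k₂ ∨ q ∨ c)) + 𝟙 q
    split true  _     _     _ = z≤n
    split false true  _     _ = z≤n
    split false false true  _ = ≤-refl
    split false false false c = ≤-reflexive (sym (+-identityʳ (𝟙 (not c))))
    remains : Fin n → Bool
    remains v = not (inK₁ a b G v) ∧ not (inList (flat ps) v) ∧ not (lookup (ΓS G Q) v)
    pointwise : ∀ v → 𝟙 (remains v) ≤ 𝟙 (uncovered Q v) + 𝟙 (lookup Q v)
    pointwise v rewrite lookup∘tabulate (λ z → not (lookup Q z) ∧ covered Q z) v =
      split (inK₁ a b G v) (inList (flat ps) v) (lookup Q v) (covered Q v)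

module Greedy {n} (G : ColouredGraph n) (a b : ℕ) (ps : List (Fin n × Fin n)) (x : Fin n) (S : Subset n) where
  open Covering G
  open Uncovered G a b ps

  available : Subset n → Fin n → Bool
  available Q v = adj G x v ∧ not (lookup S v ∨ lookup Q v)

  availableNbrs : Subset n → Fin n → ℕ
  availableNbrs Q y = count (λ v → available Q v ∧ adj G y v)

  available⇒ : ∀ Q {v} → T (available Q v) → v ∈ₛ Γ G x × v ∉ₛ S × v ∉ₛ Q
  available⇒ Q {v} t with T-∧ .to t
  ... | xv , fresh = T-lookup⁻ (subst T (sym (lookup∘tabulate (adj G x) v)) xv)
                   , T-not⇒¬T fresh ∘ T-∨ .from ∘ inj₁ ∘ T-lookup⁺
                   , T-not⇒¬T fresh ∘ T-∨ .from ∘ inj₂ ∘ T-lookup⁺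

  codegree : Fin n → ℕ
  codegree y = count (λ v → adj G x v ∧ adj G y v)

  ∣Γx∩Γy∣≡codegree : ∀ y → ∣ Γ G x ∩ Γ G y ∣ ≡ codegree y
  ∣Γx∩Γy∣≡codegree y = trans (∣p∣≡count (Γ G x ∩ Γ G y)) (sum-cong-≗ λ v → cong 𝟙 (
    trans (lookup-zipWith _∧_ v (Γ G x) (Γ G y))
          (cong₂ _∧_ (lookup∘tabulate (adj G x) v) (lookup∘tabulate (adj G y) v))))

  codegree≤availableNbrs+∣S∣+∣Q∣ : ∀ Q y → codegree y ≤ availableNbrs Q y + (∣ S ∣ + ∣ Q ∣)
  codegree≤availableNbrs+∣S∣+∣Q∣ Q y = begin
    codegree y
      ≤⟨ sum-mono-≤ (λ v → split (adj G x v) (adj G y v) (lookup S v) (lookup Q v)) ⟩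
    sum (λ v → 𝟙 (available Q v ∧ adj G y v) + (𝟙 (lookup S v) + 𝟙 (lookup Q v)))
      ≡⟨ ∑-distrib-+ (𝟙 ∘ (λ v → available Q v ∧ adj G y v)) _ ⟩
    availableNbrs Q y + sum (λ v → 𝟙 (lookup S v) + 𝟙 (lookup Q v))
      ≡⟨ cong (availableNbrs Q y +_) (∑-distrib-+ (𝟙 ∘ lookup S) (𝟙 ∘ lookup Q)) ⟩
    availableNbrs Q y + (count (lookup S) + count (lookup Q))
      ≡⟨ cong (availableNbrs Q y +_) (sym (cong₂ _+_ (∣p∣≡count S) (∣p∣≡count Q))) ⟩
    availableNbrs Q y + (∣ S ∣ + ∣ Q ∣) ∎
    where
    open ≤-Reasoning
    split : ∀ xv yv s q → 𝟙 (xv ∧ yv) ≤ 𝟙 ((xv ∧ not (s ∨ q)) ∧ yv) + (𝟙 s + 𝟙 q)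
    split false _  _     _     = z≤n
    split true  yv true  _     = ≤-trans (𝟙≤1 yv) (s≤s z≤n)
    split true  yv false true  = 𝟙≤1 yv
    split true  yv false false = ≤-reflexive (sym (+-identityʳ (𝟙 yv)))

  double-counting : ∀ Q → sum (λ v → 𝟙 (available Q v) * gain Q v)
                        ≡ sum (λ y → 𝟙 (uncovered Q y) * availableNbrs Q y)
  double-counting Q = begin
    sum (λ v → 𝟙 (available Q v) * gain Q v)
      ≡⟨ sum-cong-≗ (λ v → *-distribˡ-sum (𝟙 (available Q v)) (λ y → 𝟙 (uncovered Q y ∧ adj G v y))) ⟩
    sum (λ v → sum (λ y → 𝟙 (available Q v) * 𝟙 (uncovered Q y ∧ adj G v y)))
      ≡⟨ ∑-comm (λ v y → 𝟙 (available Q v) * 𝟙 (uncovered Q y ∧ adj G v y)) ⟩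
    sum (λ y → sum (λ v → 𝟙 (available Q v) * 𝟙 (uncovered Q y ∧ adj G v y)))
      ≡⟨ sum-cong-≗ (λ y → sum-cong-≗ (λ v → edge-term v y)) ⟩
    sum (λ y → sum (λ v → 𝟙 (uncovered Q y) * 𝟙 (available Q v ∧ adj G y v)))
      ≡⟨ sum-cong-≗ (λ y → sym (*-distribˡ-sum (𝟙 (uncovered Q y)) (λ v → 𝟙 (available Q v ∧ adj G y v)))) ⟩
    sum (λ y → 𝟙 (uncovered Q y) * availableNbrs Q y) ∎
    where
    open ≡-Reasoning
    edge-term : ∀ v y → 𝟙 (available Q v) * 𝟙 (uncovered Q y ∧ adj G v y)
                 ≡ 𝟙 (uncovered Q y) * 𝟙 (available Q v ∧ adj G y v)
    edge-term v y = begin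
      𝟙 (available Q v) * 𝟙 (uncovered Q y ∧ adj G v y)
        ≡⟨ cong (𝟙 (available Q v) *_) (𝟙-∧ (uncovered Q y) (adj G v y)) ⟩
      𝟙 (available Q v) * (𝟙 (uncovered Q y) * 𝟙 (adj G v y))
        ≡⟨ x∙yz≈y∙xz (𝟙 (available Q v)) (𝟙 (uncovered Q y)) _ ⟩
      𝟙 (uncovered Q y) * (𝟙 (available Q v) * 𝟙 (adj G v y))
        ≡⟨ cong (λ e → 𝟙 (uncovered Q y) * (𝟙 (available Q v) * 𝟙 e)) (adj-sym v y) ⟩
      𝟙 (uncovered Q y) * (𝟙 (available Q v) * 𝟙 (adj G y v))
        ≡⟨ cong (𝟙 (uncovered Q y) *_) (sym (𝟙-∧ (available Q v) (adj G y v))) ⟩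
      𝟙 (uncovered Q y) * 𝟙 (available Q v ∧ adj G y v) ∎

  codegree-x≡deg : codegree x ≡ deg G x
  codegree-x≡deg = trans (sum-cong-≗ (cong 𝟙 ∘ ∧-idem ∘ adj G x)) (sym (∣tabulate∣≡count (adj G x)))

  module Construction (maxK₂ : MaxK₂ a b G ps) (x∉K₁ : inK₁ a b G x ≡ false) (x∉K₂ : x ∉ flat ps)
                      (a>0 : 0 < a) (b>0 : 0 < b) (k : ℕ) (room : b * (a + b) * (∣ S ∣ + k) ≤ n) where

    -- Off the diagonal, this is the maximality of K₂: otherwise (x , y) could be added to it.
    εn≤codegree : ∀ y → inK₁ a b G y ≡ false → y ∉ flat ps → a * n ≤ b * codegree y
    εn≤codegree y y∉K₁ y∉K₂ with y Data.Fin.≟ x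
    ... | yes refl = subst (λ d → a * n ≤ b * d) (sym codegree-x≡deg) (<ᵇ≡false⇒≥ x∉K₁)
    ... | no  y≢x with b * ∣ Γ G x ∩ Γ G y ∣ <? a * n
    ...   | no  εn≰ = subst (λ d → a * n ≤ b * d) (∣Γx∩Γy∣≡codegree y) (≮⇒≥ εn≰)
    ...   | yes εn> = ⊥-elim (<-irrefl refl (proj₂ maxK₂ ((x , y) ∷ ps) extended))
      where
      extended : ValidK₂ a b G ((x , y) ∷ ps)
      extended = ((y≢x ∘ sym) ∷ ¬Any⇒All¬ (flat ps) x∉K₂) ∷ ¬Any⇒All¬ (flat ps) y∉K₂ ∷ proj₁ (proj₁ maxK₂)
               , (x∉K₁ , y∉K₁ , εn>) ∷ proj₂ (proj₁ maxK₂)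

    n>0 : 0 < n
    n>0 = >-nonZero⁻¹ n {{nonZeroIndex x}}

    εn/[1+ε]≤availableNbrs : ∀ Q → ∣ Q ∣ ≤ k → ∀ y → inK₁ a b G y ≡ false → y ∉ flat ps →
      a * n ≤ (a + b) * availableNbrs Q y
    εn/[1+ε]≤availableNbrs Q ∣Q∣≤k y y∉K₁ y∉K₂ =
      a*n≤[a+b]*h a>0 b>0 (εn≤codegree y y∉K₁ y∉K₂) (codegree≤availableNbrs+∣S∣+∣Q∣ Q y)
        (≤-trans (*-monoʳ-≤ (b * (a + b)) (+-monoʳ-≤ ∣ S ∣ ∣Q∣≤k)) room)

    n*[a*u]≤∑gain : ∀ Q → ∣ Q ∣ ≤ k →
      n * (a * count (uncovered Q)) ≤ sum (λ v → 𝟙 (available Q v) * ((a + b) * gain Q v))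
    n*[a*u]≤∑gain Q ∣Q∣≤k = begin
      n * (a * count (uncovered Q))
        ≡⟨ x∙yz≈yx∙z n a _ ⟩
      a * n * count (uncovered Q)
        ≡⟨ *-distribˡ-sum (a * n) (𝟙 ∘ uncovered Q) ⟩
      sum (λ y → a * n * 𝟙 (uncovered Q y))
        ≤⟨ sum-mono-≤ (λ y → m*𝟙p≤𝟙p*m′ (uncovered Q y) λ t →
             let y∉K₁ , y∉K₂ = uncovered⇒∉K₁∪K₂ {Q} y t in εn/[1+ε]≤availableNbrs Q ∣Q∣≤k y y∉K₁ y∉K₂) ⟩
      sum (λ y → 𝟙 (uncovered Q y) * ((a + b) * availableNbrs Q y))
        ≡⟨ sum-cong-≗ (λ y → x∙yz≈y∙xz (𝟙 (uncovered Q y)) (a + b) _) ⟩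
      sum (λ y → (a + b) * (𝟙 (uncovered Q y) * availableNbrs Q y))
        ≡⟨ sym (*-distribˡ-sum (a + b) (λ y → 𝟙 (uncovered Q y) * availableNbrs Q y)) ⟩
      (a + b) * sum (λ y → 𝟙 (uncovered Q y) * availableNbrs Q y)
        ≡⟨ cong ((a + b) *_) (sym (double-counting Q)) ⟩
      (a + b) * sum (λ v → 𝟙 (available Q v) * gain Q v)
        ≡⟨ *-distribˡ-sum (a + b) (λ v → 𝟙 (available Q v) * gain Q v) ⟩
      sum (λ v → (a + b) * (𝟙 (available Q v) * gain Q v))
        ≡⟨ sum-cong-≗ (λ v → x∙yz≈y∙xz (a + b) (𝟙 (available Q v)) (gain Q v)) ⟩
      sum (λ v → 𝟙 (available Q v) * ((a + b) * gain Q v)) ∎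
      where open ≤-Reasoning

    greedy-choice : ∀ Q → ∣ Q ∣ ≤ k →
      ∃[ v ] (T (available Q v) × a * count (uncovered Q) ≤ (a + b) * gain Q v)
    greedy-choice Q ∣Q∣≤k with count (uncovered Q) | n*[a*u]≤∑gain Q ∣Q∣≤k
    ... | zero | _ =
      let v , t = count>0⇒∃ (λ v → available Q v ∧ adj G x v) availableNbrs-x>0
      in v , proj₁ (T-∧ .to t) , subst (_≤ (a + b) * gain Q v) (sym (*-zeroʳ a)) z≤n
      where
      availableNbrs-x>0 : 0 < availableNbrs Q x
      availableNbrs-x>0 = >-nonZero⁻¹ _ {{m*n≢0⇒n≢0 (a + b) {{>-nonZero
        (<-≤-trans (*-mono-< a>0 n>0) (εn/[1+ε]≤availableNbrs Q ∣Q∣≤k x x∉K₁ x∉K₂))}}}}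
    ... | suc u | n*[a*u]≤∑ =
      let v , au≤ = ∃≥average _ n>0 n*[a*u]≤∑
      in v , c≤𝟙p*m⇒T-p (available Q v) (*-mono-< a>0 z<s) au≤

    record GreedyState (i : ℕ) : Set where
      field
        Q     : Subset n
        ∣Q∣≡i : ∣ Q ∣ ≡ i
        Q⊆Γx  : Q ⊆ Γ G x
        Q∩S≡∅ : Empty (Q ∩ S)
        decay : (a + b) ^ i * count (uncovered Q) ≤ b ^ i * n

    greedy-start : GreedyState 0
    greedy-start = record
      { Q     = ∅
      ; ∣Q∣≡i = ∣⊥∣≡0 n
      ; Q⊆Γx  = ⊆-min (Γ G x)
      ; Q∩S≡∅ = λ (w , w∈∅∩S) → ∉⊥ (proj₁ (x∈p∩q⁻ ∅ S w∈∅∩S))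
      ; decay = *-monoʳ-≤ 1 (count≤n (uncovered ∅))
      }

    greedy-step : ∀ {i} → i < k → GreedyState i → GreedyState (suc i)
    greedy-step {i} i<k st
      with greedy-choice (GreedyState.Q st) (≤-trans (≤-reflexive (GreedyState.∣Q∣≡i st)) (<⇒≤ i<k))
    ... | v , v-available , greedy-gain = record
      { Q     = Q ∪ ⁅ v ⁆
      ; ∣Q∣≡i = trans (∣p∪⁅x⁆∣≡1+∣p∣ v∉Q) (cong suc ∣Q∣≡i)
      ; Q⊆Γx  = p∪⁅x⁆⊆q Q⊆Γx v∈Γx
      ; Q∩S≡∅ = Empty[p∩q]⇒Empty[[p∪⁅x⁆]∩q] Q∩S≡∅ v∉S
      ; decay = c^[1+i]*u′≤b^[1+i]*n {a + b} {b} {i}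
                  ([a+b]*u′≤b*u {a} (count-uncovered-∪⁅⁆ Q v) greedy-gain) decay
      }
      where
      open GreedyState st
      v∈Γx : v ∈ₛ Γ G x
      v∈Γx = proj₁ (available⇒ Q v-available)
      v∉S : v ∉ₛ S
      v∉S = proj₁ (proj₂ (available⇒ Q v-available))
      v∉Q : v ∉ₛ Q
      v∉Q = proj₂ (proj₂ (available⇒ Q v-available))

    greedy : ∀ i → i ≤ k → GreedyState i
    greedy zero    _   = greedy-start
    greedy (suc i) i<k = greedy-step i<k (greedy i (<⇒≤ i<k))

greedy-cover : ∀ {n} (G : ColouredGraph n) {a b} (ps : List (Fin n × Fin n)) (x : Fin n) (S : Subset n) →
  0 < a → 16 * a ≤ b → 64 ≤ n → MaxK₂ a b G ps → inK₁ a b G x ≡ false → x ∉ flat ps →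
  b * (a + b) * (∣ S ∣ + ⌊log₂ n ⌋) ≤ n →
  ∃[ Q ] (Q ⊆ Γ G x × Empty (Q ∩ S) × ∣ Q ∣ ≡ ⌊log₂ n ⌋ ×
          ∣ Remainder a b G ps Q ∣ ^ b < 2 ^ b * n ^ (b ∸ a))
greedy-cover {n} G {a} {b} ps x S a>0 16a≤b 64≤n maxK₂ x∉K₁ x∉K₂ room =
  Q , Q⊆Γx , Q∩S≡∅ , ∣Q∣≡i , (begin-strict
    ∣ Remainder a b G ps Q ∣ ^ b         ≤⟨ ^-monoˡ-≤ b (∣Remainder∣≤count-uncovered+∣Q∣ Q) ⟩
    (count (uncovered Q) + ∣ Q ∣) ^ b    ≡⟨ cong (λ t → (count (uncovered Q) + t) ^ b) ∣Q∣≡i ⟩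
    (count (uncovered Q) + k) ^ b
      <⟨ u+k<2n^[1-ε] a>0 16a≤b 6≤k (2^⌊log₂n⌋≤n n n>0) (n<2^[1+⌊log₂n⌋] n) decay ⟩
    2 ^ b * n ^ (b ∸ a)                  ∎)
  where
  open ≤-Reasoning
  k = ⌊log₂ n ⌋
  6≤k : 6 ≤ k
  6≤k = subst (_≤ k) (⌊log₂[2^n]⌋≡n 6) (⌊log₂⌋-mono-≤ 64≤n)
  b>0 : 0 < b
  b>0 = ≤-trans a>0 (≤-trans (m≤n*m a 16) 16a≤b)
  open Uncovered G a b ps
  open Greedy G a b ps x S
  open Construction maxK₂ x∉K₁ x∉K₂ a>0 b>0 k room
  open GreedyState (greedy k ≤-refl)

room-for-large-n : ∀ a b c e {n} → let K = b * (a + b) * (6 * c + 1) in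
  K * K + 64 ≤ n → b * (a + b) * (6 * sOf c e n + ⌊log₂ n ⌋) ≤ n
room-for-large-n a b c e {n} K²+64≤n = begin
  b * (a + b) * (6 * sOf c e n + k)
    ≤⟨ *-monoʳ-≤ (b * (a + b)) (+-monoˡ-≤ k (*-monoʳ-≤ 6 (m/n≤m (c * k) (suc e)))) ⟩
  b * (a + b) * (6 * (c * k) + k)
    ≡⟨ factor b (a + b) c k ⟩
  b * (a + b) * (6 * c + 1) * k
    ≤⟨ K*k≤n {b * (a + b) * (6 * c + 1)} {k} (≤-trans (m≤m+n _ 64) K²+64≤n) (<⇒≤ k²<n) ⟩
  n ∎
  where
  open ≤-Reasoning
  k = ⌊log₂ n ⌋
  64≤n : 64 ≤ n
  64≤n = ≤-trans (m≤n+m 64 _) K²+64≤n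
  5≤k : 5 ≤ k
  5≤k = subst (_≤ k) (⌊log₂[2^n]⌋≡n 5) (⌊log₂⌋-mono-≤ (≤-trans (m≤m+n 32 32) 64≤n))
  k²<n : k * k < n
  k²<n = <-≤-trans (k*k<2^k 5≤k) (2^⌊log₂n⌋≤n n (≤-trans z<s 64≤n))
  factor : ∀ b ab c k → b * ab * (6 * (c * k) + k) ≡ b * ab * (6 * c + 1) * k
  factor = solve-∀

lemma4 : ∃[ D ] (∀ (a b : ℕ) → 0 < a → D * a ≤ b →
           ∀ (c e : ℕ) → 0 < c →
           ∃[ N ] (∀ (n : ℕ) → N ≤ n →
             ∀ (G : ColouredGraph n) → OBTF G → ¬ InX₀ (sOf c e n) G →
             ∀ (ps : List (Fin n × Fin n)) → MaxK₂ a b G ps →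
             ∀ (x : Fin n) → inK₁ a b G x ≡ false → x ∉ flat ps →
             ∀ (S : Subset n) → ∣ S ∣ ≡ 6 * sOf c e n →
             ∃[ Q ] (Q ⊆ Γ G x × Empty (Q ∩ S) × ∣ Q ∣ ≡ ⌊log₂ n ⌋ ×
               ∣ Remainder a b G ps Q ∣ ^ b < 2 ^ b * n ^ (b ∸ a))))
lemma4 = 16 , λ a b a>0 16a≤b c e _ →
  let K = b * (a + b) * (6 * c + 1) in
  K * K + 64 , λ n K²+64≤n G _ _ ps maxK₂ x x∉K₁ x∉K₂ S ∣S∣≡6s →
    greedy-cover G ps x S a>0 16a≤b (≤-trans (m≤n+m 64 (K * K)) K²+64≤n) maxK₂ x∉K₁ x∉K₂
      (subst (λ t → b * (a + b) * (t + ⌊log₂ n ⌋) ≤ n) (sym ∣S∣≡6s) (room-for-large-n a b c e K²+64≤n))
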